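{- Let $X$ be a cubic symmetric graph of order $2n$ with $n$ odd, of type $\{1,2^1\}$ (i.e. $\mathrm{Aut}(X)$ acts regularly on the $2$-arcs of $X$, the setwise edge stabilizer in $\mathrm{Aut}(X)$ is isomorphic to $\mathbb{Z}_2\times\mathbb{Z}_2$, and $\mathrm{Aut}(X)$ contains a subgroup acting regularly on the arcs of $X$). Then $X$ has an automorphism acting as an odd permutation on $V(X)$.
   Context: A cubic symmetric graph is a finite, simple, connected cubic graph whose automorphism group is arc-transitive. A $2$-arc is a sequence $(u_0,u_1,u_2)$ of distinct vertices with $u_0u_1$, $u_1u_2$ edges. -}

module Defs where

open import Data.Nat using (ℕ; zero; suc; _<ᵇ_; _%_)
open import Data.Fin using (Fin; toℕ)
open import Data.Fin.Permutation using (Permutation′; _⟨$⟩ʳ_; _≈_; id; flip; _∘ₚ_)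
open import Data.Bool using (Bool; true; false; if_then_else_; _∧_; _xor_)
open import Level using (Level)
open import Data.List using (List; map; allFin)
open import Data.Nat.ListAction using (sum)
open import Data.Product using (_×_; _,_; Σ; ∃; ∃-syntax)
open import Relation.Binary.PropositionalEquality using (_≡_; _≢_)

record Graph (N : ℕ) : Set where
  field
    Adj       : Fin N → Fin N → Bool
    symmetric : ∀ u v → Adj u v ≡ Adj v u
    loopless  : ∀ u → Adj u u ≡ false
open Graph public

module _ {N : ℕ} (X : Graph N) where

  degree : Fin N → ℕ
  degree u = sum (map (λ v → if Adj X u v then 1 else 0) (allFin N))

  Cubic : Set
  Cubic = ∀ u → degree u ≡ 3

  data Walk : Fin N → Fin N → Set where
    here : ∀ {u} → Walk u u
    step : ∀ {u v w} → Adj X u v ≡ true → Walk v w → Walk u w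

  Connected : Set
  Connected = ∀ u v → Walk u v

  IsAut : Permutation′ N → Set
  IsAut σ = ∀ u v → Adj X (σ ⟨$⟩ʳ u) (σ ⟨$⟩ʳ v) ≡ Adj X u v

  record Arc : Set where
    constructor arc
    field
      a₀ a₁ : Fin N
      adj   : Adj X a₀ a₁ ≡ true

  -- 2-arcs (u₀,u₁,u₂): distinct vertices with u₀u₁, u₁u₂ edges
  -- (u₀ ≠ u₁ and u₁ ≠ u₂ follow from looplessness)
  record TwoArc : Set where
    constructor twoArc
    field
      u₀ u₁ u₂ : Fin N
      adj₀₁    : Adj X u₀ u₁ ≡ true
      adj₁₂    : Adj X u₁ u₂ ≡ true
      distinct : u₀ ≢ u₂

  MapsArc : Permutation′ N → Arc → Arc → Set
  MapsArc σ a b = (σ ⟨$⟩ʳ Arc.a₀ a ≡ Arc.a₀ b) × (σ ⟨$⟩ʳ Arc.a₁ a ≡ Arc.a₁ b)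

  MapsTwoArc : Permutation′ N → TwoArc → TwoArc → Set
  MapsTwoArc σ a b = (σ ⟨$⟩ʳ TwoArc.u₀ a ≡ TwoArc.u₀ b)
                   × (σ ⟨$⟩ʳ TwoArc.u₁ a ≡ TwoArc.u₁ b)
                   × (σ ⟨$⟩ʳ TwoArc.u₂ a ≡ TwoArc.u₂ b)

  ArcTransitive : Set
  ArcTransitive = ∀ a b → ∃[ σ ] (IsAut σ × MapsArc σ a b)

  CubicSymmetric : Set
  CubicSymmetric = Connected × Cubic × ArcTransitive

  TwoArcRegular : Set
  TwoArcRegular = ∀ a b → ∃[ σ ] (IsAut σ × MapsTwoArc σ a b
                    × (∀ τ → IsAut τ → MapsTwoArc τ a b → τ ≈ σ))

  StabEdge : Fin N → Fin N → Permutation′ N → Set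
  StabEdge u v σ = IsAut σ ×
    (((σ ⟨$⟩ʳ u ≡ u) × (σ ⟨$⟩ʳ v ≡ v)) Data.Sum.⊎ ((σ ⟨$⟩ʳ u ≡ v) × (σ ⟨$⟩ʳ v ≡ u)))
    where import Data.Sum

  -- the setwise stabilizer of the edge {u,v} is isomorphic to Z₂ × Z₂
  -- (Z₂ × Z₂ realised as Bool × Bool under componentwise xor);
  -- φ is a homomorphism, injective, with image exactly the stabilizer
  EdgeStabIsoZ2Z2 : Fin N → Fin N → Set
  EdgeStabIsoZ2Z2 u v = Σ (Bool × Bool → Permutation′ N) λ φ →
      (∀ x → StabEdge u v (φ x))
    × (∀ x y → φ x ≈ φ y → x ≡ y)
    × (∀ σ → StabEdge u v σ → ∃[ x ] (σ ≈ φ x))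
    × (∀ x₁ y₁ x₂ y₂ → φ (x₁ xor x₂ , y₁ xor y₂) ≈ (φ (x₁ , y₁) ∘ₚ φ (x₂ , y₂)))

  IsSubgroupOfAut : (Permutation′ N → Set) → Set
  IsSubgroupOfAut H = (∀ σ → H σ → IsAut σ)
    × H id
    × (∀ σ τ → H σ → H τ → H (σ ∘ₚ τ))
    × (∀ σ → H σ → H (flip σ))

  ArcRegular : (Permutation′ N → Set) → Set
  ArcRegular H = ∀ a b → ∃[ σ ] (H σ × MapsArc σ a b
                    × (∀ τ → H τ → MapsArc τ a b → τ ≈ σ))

  Type1-2¹ : Set₁
  Type1-2¹ = TwoArcRegular
    × (∀ u v → Adj X u v ≡ true → EdgeStabIsoZ2Z2 u v)
    × (∃[ H ] (IsSubgroupOfAut H × ArcRegular H))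

inversions : {N : ℕ} → Permutation′ N → ℕ
inversions {N} σ = sum (map (λ i → sum (map (λ j →
  if (toℕ i <ᵇ toℕ j) ∧ (toℕ (σ ⟨$⟩ʳ j) <ᵇ toℕ (σ ⟨$⟩ʳ i)) then 1 else 0)
  (allFin N))) (allFin N))

OddPermutation : {N : ℕ} → Permutation′ N → Set
OddPermutation σ = inversions σ % 2 ≡ 1

-- A regular subgroup of Aut(X) contains an element h reversing a given arc uv. Then h² fixes
-- the arc uv, so h² = 1 by regularity, and h fixes no arc at all, since otherwise h = 1. If h
-- fixed a vertex w, it would permute the three neighbours of w in pairs, which is impossible;
-- so h is a fixed-point-free involution of the 2n vertices, i.e. a product of n disjoint
-- transpositions, and n is odd.
--
-- For an involution h the map (i, j) ↦ (h j, h i)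
-- permutes the inversions of h, and its fixed inversions are the pairs (i, h i) with i < h i,
-- of which there are exactly n. Every other orbit has two elements, so the number of
-- inversions is n modulo 2.
module Submission where

open import Level using (0ℓ)
open import Data.Nat using (ℕ; zero; suc; _+_; _*_; _%_; _<ᵇ_)
open import Data.Nat.Properties
  using (*-identityʳ; *-identityˡ; *-zeroʳ; *-distribˡ-+; *-comm; +-identityʳ; *-cancelʳ-≡; <ᵇ-reflects-<;
         +-0-commutativeMonoid)
open import Data.Nat.DivMod using ([m+kn]%n≡m%n)
open import Data.Nat.Tactic.RingSolver using (solve-∀)
import Data.Nat.ListAction as List
open import Data.Fin using (Fin; zero; suc; toℕ; punchIn)
open import Data.Fin.Properties using (<-cmp; punchInᵢ≢i; any?)
open import Data.Fin.Permutation using (Permutation′; _⟨$⟩ʳ_; id)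
open import Data.Bool using (true; false; if_then_else_; _∧_)
import Data.Bool as Bool
open import Data.Bool.Properties using (∧-comm; ∧-idem)
open import Data.List using (map; allFin; tabulate)
open import Data.List.Properties using (map-tabulate)
open import Data.Product using (_×_; _,_; ∃-syntax; proj₁; proj₂)
open import Data.Product.Relation.Binary.Lex.Strict using (×-compare)
open import Data.Empty using (⊥-elim)
open import Function using (_∘_)
open import Relation.Binary.Core using (Rel)
open import Relation.Binary.Definitions using (Trichotomous; tri<; tri≈; tri>)
open import Relation.Binary.PropositionalEquality
open import Relation.Nullary using (¬_; yes; no)
open import Relation.Nullary.Reflects using (ofʸ; ofⁿ)
open import Algebra.Properties.CommutativeMonoid.Sum +-0-commutativeMonoid
  using (sum; sum-cong-≗; ∑-distrib-+; ∑-comm; sum-permute; sum-remove; sum-replicate-zero)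
open import Defs

module Indicators {A : Set} {_≈_ _<_ : Rel A 0ℓ} (compare : Trichotomous _≈_ _<_) where

  𝟙< : A → A → ℕ
  𝟙< x y with compare x y
  ... | tri< _ _ _ = 1
  ... | tri≈ _ _ _ = 0
  ... | tri> _ _ _ = 0

  𝟙≈ : A → A → ℕ
  𝟙≈ x y with compare x y
  ... | tri< _ _ _ = 0
  ... | tri≈ _ _ _ = 1
  ... | tri> _ _ _ = 0

  𝟙-trichotomy : ∀ x y → 𝟙< x y + 𝟙< y x + 𝟙≈ x y ≡ 1
  𝟙-trichotomy x y with compare x y | compare y x
  ... | tri< _ _ _   | tri> _ _ _   = refl
  ... | tri≈ _ _ _   | tri≈ _ _ _   = refl
  ... | tri> _ _ _   | tri< _ _ _   = refl
  ... | tri< _ _ y≮x | tri< y<x _ _ = ⊥-elim (y≮x y<x)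
  ... | tri< x<y _ _ | tri≈ _ _ x≮y = ⊥-elim (x≮y x<y)
  ... | tri≈ _ _ y≮x | tri< y<x _ _ = ⊥-elim (y≮x y<x)
  ... | tri≈ x≮y _ _ | tri> _ _ x<y = ⊥-elim (x≮y x<y)
  ... | tri> _ _ y<x | tri≈ y≮x _ _ = ⊥-elim (y≮x y<x)
  ... | tri> x≮y _ _ | tri> _ _ x<y = ⊥-elim (x≮y x<y)

  𝟙≈-≈ : ∀ {x y} → x ≈ y → 𝟙≈ x y ≡ 1
  𝟙≈-≈ {x} {y} x≈y with compare x y
  ... | tri< _ x≉y _ = ⊥-elim (x≉y x≈y)
  ... | tri≈ _ _ _   = refl
  ... | tri> _ x≉y _ = ⊥-elim (x≉y x≈y)

  𝟙≈-≉ : ∀ {x y} → ¬ x ≈ y → 𝟙≈ x y ≡ 0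
  𝟙≈-≉ {x} {y} x≉y with compare x y
  ... | tri< _ _ _   = refl
  ... | tri≈ _ x≈y _ = ⊥-elim (x≉y x≈y)
  ... | tri> _ _ _   = refl

module InvolutionSum
    {D : Set} (Σ : (D → ℕ) → ℕ)
    (Σ-cong : ∀ {f g} → (∀ x → f x ≡ g x) → Σ f ≡ Σ g)
    (Σ-distrib-+ : ∀ f g → Σ (λ x → f x + g x) ≡ Σ f + Σ g)
    (τ : D → D) (τ-involutive : ∀ x → τ (τ x) ≡ x)
    (Σ-reindex : ∀ f → Σ (f ∘ τ) ≡ Σ f)
    {_≈_ _<_ : Rel D 0ℓ} (compare : Trichotomous _≈_ _<_) where

  open Indicators compare public

  -- Each orbit {x, τ x} of size two is counted once at its smaller point and once at its larger.
  Σ-invariant : ∀ f → (∀ x → f (τ x) ≡ f x) →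
    Σ f ≡ Σ (λ x → f x * 𝟙≈ x (τ x)) + Σ (λ x → f x * 𝟙< x (τ x)) * 2
  Σ-invariant f f-invariant = begin
      Σ f
    ≡⟨ Σ-cong split ⟩
      Σ (λ x → (below x + above x) + fixed x)
    ≡⟨ Σ-distrib-+ (λ x → below x + above x) fixed ⟩
      Σ (λ x → below x + above x) + Σ fixed
    ≡⟨ cong (_+ Σ fixed) (Σ-distrib-+ below above) ⟩
      Σ below + Σ above + Σ fixed
    ≡⟨ cong (λ s → Σ below + s + Σ fixed) above≡below ⟩
      Σ below + Σ below + Σ fixed
    ≡⟨ rearrange (Σ below) (Σ fixed) ⟩
      Σ fixed + Σ below * 2
    ∎
    where
    open ≡-Reasoning
    below above fixed : D → ℕ
    below x = f x * 𝟙< x (τ x)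
    above x = f x * 𝟙< (τ x) x
    fixed x = f x * 𝟙≈ x (τ x)

    rearrange : ∀ a c → a + a + c ≡ c + a * 2
    rearrange = solve-∀

    split : ∀ x → f x ≡ (below x + above x) + fixed x
    split x = begin
        f x
      ≡⟨ *-identityʳ (f x) ⟨
        f x * 1
      ≡⟨ cong (f x *_) (𝟙-trichotomy x (τ x)) ⟨
        f x * (𝟙< x (τ x) + 𝟙< (τ x) x + 𝟙≈ x (τ x))
      ≡⟨ *-distribˡ-+ (f x) _ _ ⟩
        f x * (𝟙< x (τ x) + 𝟙< (τ x) x) + fixed x
      ≡⟨ cong (_+ fixed x) (*-distribˡ-+ (f x) _ _) ⟩
        (below x + above x) + fixed x
      ∎

    above≡below : Σ above ≡ Σ below
    above≡below = begin
        Σ above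
      ≡⟨ Σ-cong (λ x → cong₂ (λ y z → y * 𝟙< (τ x) z) (f-invariant x) (τ-involutive x)) ⟨
        Σ (below ∘ τ)
      ≡⟨ Σ-reindex below ⟩
        Σ below
      ∎

sum-allFin : ∀ {n} (f : Fin n → ℕ) → List.sum (map f (allFin n)) ≡ sum f
sum-allFin {n} f = trans (cong List.sum (map-tabulate {n = n} (λ i → i) f)) (sum-tabulate f)
  where
  sum-tabulate : ∀ {n} (f : Fin n → ℕ) → List.sum (tabulate f) ≡ sum f
  sum-tabulate {zero}  f = refl
  sum-tabulate {suc n} f = cong (f zero +_) (sum-tabulate (f ∘ suc))

sum-zero : ∀ {n} {f : Fin n → ℕ} → (∀ i → f i ≡ 0) → sum f ≡ 0
sum-zero {n} f≡0 = trans (sum-cong-≗ f≡0) (sum-replicate-zero n)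

sum-one : ∀ n → sum {n} (λ _ → 1) ≡ n
sum-one zero    = refl
sum-one (suc n) = cong suc (sum-one n)

∑-select : ∀ {n} (g e : Fin n → ℕ) (x : Fin n) → e x ≡ 1 → (∀ j → j ≢ x → e j ≡ 0) →
  sum (λ j → g j * e j) ≡ g x
∑-select {suc n} g e x ex≡1 e≡0 = begin
    sum (λ j → g j * e j)
  ≡⟨ sum-remove {i = x} (λ j → g j * e j) ⟩
    g x * e x + sum (λ k → g (punchIn x k) * e (punchIn x k))
  ≡⟨ cong₂ _+_ (trans (cong (g x *_) ex≡1) (*-identityʳ (g x))) (sum-zero off-x) ⟩
    g x + 0
  ≡⟨ +-identityʳ (g x) ⟩
    g x
  ∎
  where
  open ≡-Reasoning
  off-x : ∀ k → g (punchIn x k) * e (punchIn x k) ≡ 0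
  off-x k = trans (cong (g (punchIn x k) *_) (e≡0 (punchIn x k) (punchInᵢ≢i x k)))
                  (*-zeroʳ (g (punchIn x k)))

∑² : ∀ {n} → (Fin n × Fin n → ℕ) → ℕ
∑² F = sum (λ i → sum (λ j → F (i , j)))

∑²-cong : ∀ {n} {F G : Fin n × Fin n → ℕ} → (∀ p → F p ≡ G p) → ∑² F ≡ ∑² G
∑²-cong F≗G = sum-cong-≗ (λ i → sum-cong-≗ (λ j → F≗G (i , j)))

∑²-distrib-+ : ∀ {n} (F G : Fin n × Fin n → ℕ) → ∑² (λ p → F p + G p) ≡ ∑² F + ∑² G
∑²-distrib-+ F G = trans (sum-cong-≗ (λ i → ∑-distrib-+ (λ j → F (i , j)) (λ j → G (i , j))))
                         (∑-distrib-+ (λ i → sum (λ j → F (i , j))) (λ i → sum (λ j → G (i , j))))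

open module FinOrder {n} = Indicators (<-cmp {n}) using (𝟙<; 𝟙≈; 𝟙≈-≉)

𝟙<-toℕ : ∀ {n} (i j : Fin n) → (if toℕ i <ᵇ toℕ j then 1 else 0) ≡ 𝟙< i j
𝟙<-toℕ i j with <-cmp i j | toℕ i <ᵇ toℕ j | <ᵇ-reflects-< (toℕ i) (toℕ j)
... | tri< _ _ _   | true  | _        = refl
... | tri< i<j _ _ | false | ofⁿ i≮j = ⊥-elim (i≮j i<j)
... | tri≈ i≮j _ _ | true  | ofʸ i<j = ⊥-elim (i≮j i<j)
... | tri≈ _ _ _   | false | _        = refl
... | tri> i≮j _ _ | true  | ofʸ i<j = ⊥-elim (i≮j i<j)
... | tri> _ _ _   | false | _        = refl

Involutive : ∀ {N} → Permutation′ N → Set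
Involutive h = ∀ i → h ⟨$⟩ʳ (h ⟨$⟩ʳ i) ≡ i

module FinInvolution {N : ℕ} (h : Permutation′ N) (h-involutive : Involutive h) where

  private
    ʰ : Fin N → Fin N
    ʰ i = h ⟨$⟩ʳ i

  module Points = InvolutionSum sum sum-cong-≗ ∑-distrib-+ ʰ h-involutive
                    (λ f → sym (sum-permute f h)) <-cmp

  reflect : Fin N × Fin N → Fin N × Fin N
  reflect (i , j) = ʰ j , ʰ i

  ∑²-reflect : ∀ (F : Fin N × Fin N → ℕ) → ∑² (F ∘ reflect) ≡ ∑² F
  ∑²-reflect F = begin
      sum (λ i → sum (λ j → F (ʰ j , ʰ i)))
    ≡⟨ ∑-comm (λ i j → F (ʰ j , ʰ i)) ⟩
      sum (λ j → sum (λ i → F (ʰ j , ʰ i)))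
    ≡⟨ sum-cong-≗ (λ j → sum-permute (λ i → F (ʰ j , i)) h) ⟨
      sum (λ j → sum (λ i → F (ʰ j , i)))
    ≡⟨ sum-permute (λ j → sum (λ i → F (j , i))) h ⟨
      ∑² F
    ∎
    where open ≡-Reasoning

  module Pairs = InvolutionSum ∑² ∑²-cong ∑²-distrib-+
                   reflect (λ (i , j) → cong₂ _,_ (h-involutive i) (h-involutive j))
                   ∑²-reflect (×-compare sym <-cmp <-cmp)

  ∑²-fixed : ∀ (F : Fin N × Fin N → ℕ) → ∑² (λ p → F p * Pairs.𝟙≈ p (reflect p)) ≡ sum (λ i → F (i , ʰ i))
  ∑²-fixed F = sum-cong-≗ (λ i →
    ∑-select (λ j → F (i , j)) (λ j → Pairs.𝟙≈ (i , j) (ʰ j , ʰ i)) (ʰ i)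
      (Pairs.𝟙≈-≈ (sym (h-involutive i) , refl))
      (λ j j≢ʰi → Pairs.𝟙≈-≉ (λ (_ , j≡ʰi) → j≢ʰi j≡ʰi)))

  inverted : Fin N × Fin N → ℕ
  inverted (i , j) = if (toℕ i <ᵇ toℕ j) ∧ (toℕ (ʰ j) <ᵇ toℕ (ʰ i)) then 1 else 0

  inverted-reflect : ∀ p → inverted (reflect p) ≡ inverted p
  inverted-reflect (i , j) rewrite h-involutive i | h-involutive j =
    cong (λ b → if b then 1 else 0) (∧-comm (toℕ (ʰ j) <ᵇ toℕ (ʰ i)) (toℕ i <ᵇ toℕ j))

  inverted-diagonal : ∀ i → inverted (i , ʰ i) ≡ 𝟙< i (ʰ i)
  inverted-diagonal i rewrite h-involutive i | ∧-idem (toℕ i <ᵇ toℕ (ʰ i)) = 𝟙<-toℕ i (ʰ i)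

  ascents : ℕ
  ascents = sum (λ i → 𝟙< i (ʰ i))

  paired : ℕ
  paired = ∑² (λ p → inverted p * Pairs.𝟙< p (reflect p))

  inversions≡∑²-inverted : inversions h ≡ ∑² inverted
  inversions≡∑²-inverted =
    trans (sum-allFin (λ i → List.sum (map (λ j → inverted (i , j)) (allFin N))))
          (sum-cong-≗ (λ i → sum-allFin (λ j → inverted (i , j))))

  inversions≡ascents+paired*2 : inversions h ≡ ascents + paired * 2
  inversions≡ascents+paired*2 = begin
      inversions h
    ≡⟨ inversions≡∑²-inverted ⟩
      ∑² inverted
    ≡⟨ Pairs.Σ-invariant inverted inverted-reflect ⟩
      ∑² (λ p → inverted p * Pairs.𝟙≈ p (reflect p)) + paired * 2
    ≡⟨ cong (_+ paired * 2) (trans (∑²-fixed inverted) (sum-cong-≗ inverted-diagonal)) ⟩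
      ascents + paired * 2
    ∎
    where open ≡-Reasoning

  ascents*2≡N : (∀ i → ʰ i ≢ i) → ascents * 2 ≡ N
  ascents*2≡N fixed-point-free = sym (begin
      N
    ≡⟨ sum-one N ⟨
      sum {N} (λ _ → 1)
    ≡⟨ Points.Σ-invariant (λ _ → 1) (λ _ → refl) ⟩
      sum (λ i → 1 * 𝟙≈ i (ʰ i)) + sum (λ i → 1 * 𝟙< i (ʰ i)) * 2
    ≡⟨ cong₂ (λ a b → a + b * 2) (sum-zero no-fixed-point)
             (sum-cong-≗ (λ i → *-identityˡ (𝟙< i (ʰ i)))) ⟩
      ascents * 2
    ∎)
    where
    open ≡-Reasoning
    no-fixed-point : ∀ i → 1 * 𝟙≈ i (ʰ i) ≡ 0
    no-fixed-point i = trans (*-identityˡ _) (𝟙≈-≉ (fixed-point-free i ∘ sym))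

  fixed-point-free⇒odd : ∀ n → N ≡ 2 * n → n % 2 ≡ 1 → (∀ i → ʰ i ≢ i) → OddPermutation h
  fixed-point-free⇒odd n N≡2n n-odd fixed-point-free = begin
      inversions h % 2
    ≡⟨ cong (_% 2) inversions≡ascents+paired*2 ⟩
      (ascents + paired * 2) % 2
    ≡⟨ [m+kn]%n≡m%n ascents paired 2 ⟩
      ascents % 2
    ≡⟨ cong (_% 2) ascents≡n ⟩
      n % 2
    ≡⟨ n-odd ⟩
      1
    ∎
    where
    open ≡-Reasoning
    ascents≡n : ascents ≡ n
    ascents≡n = *-cancelʳ-≡ ascents n 2
      (trans (ascents*2≡N fixed-point-free) (trans N≡2n (*-comm 2 n)))

module _ {N : ℕ} (X : Graph N) where

  adjacency : Fin N → Fin N → ℕ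
  adjacency u v = if Adj X u v then 1 else 0

  neighbour : Cubic X → ∀ u → ∃[ v ] Adj X u v ≡ true
  neighbour cubic u with any? (λ v → Adj X u v Bool.≟ true)
  ... | yes found = found
  ... | no none with trans (sym (cubic u)) (trans (sum-allFin (adjacency u)) (sum-zero isolated))
    where
    isolated : ∀ v → adjacency u v ≡ 0
    isolated v with Adj X u v in u~v
    ... | true  = ⊥-elim (none (v , u~v))
    ... | false = refl
  ... | ()

  reverseArc : Arc X → Arc X
  reverseArc (arc u v u~v) = arc v u (trans (symmetric X v u) u~v)

  module _ (h : Permutation′ N) (h-involutive : Involutive h) (h-aut : IsAut X h)
           (h-fixes-no-arc : ∀ a → ¬ MapsArc X h a a) where

    open FinInvolution h h-involutive using (module Points)

    fixed-vertex⇒even-degree : ∀ w → h ⟨$⟩ʳ w ≡ w → degree X w % 2 ≡ 0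
    fixed-vertex⇒even-degree w hw≡w = begin
        degree X w % 2
      ≡⟨ cong (_% 2) (sum-allFin (adjacency w)) ⟩
        sum (adjacency w) % 2
      ≡⟨ cong (_% 2) (Points.Σ-invariant (adjacency w) invariant) ⟩
        (sum (λ v → adjacency w v * 𝟙≈ v (h ⟨$⟩ʳ v)) + paired * 2) % 2
      ≡⟨ cong (λ s → (s + paired * 2) % 2) (sum-zero no-fixed-neighbour) ⟩
        (0 + paired * 2) % 2
      ≡⟨ [m+kn]%n≡m%n 0 paired 2 ⟩
        0
      ∎
      where
      open ≡-Reasoning
      paired : ℕ
      paired = sum (λ v → adjacency w v * 𝟙< v (h ⟨$⟩ʳ v))

      invariant : ∀ v → adjacency w (h ⟨$⟩ʳ v) ≡ adjacency w v
      invariant v = cong (λ b → if b then 1 else 0)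
        (trans (cong (λ u → Adj X u (h ⟨$⟩ʳ v)) (sym hw≡w)) (h-aut w v))

      no-fixed-neighbour : ∀ v → adjacency w v * 𝟙≈ v (h ⟨$⟩ʳ v) ≡ 0
      no-fixed-neighbour v with Adj X w v in w~v
      ... | false = refl
      ... | true  = trans (*-identityˡ _)
                      (𝟙≈-≉ (λ v≡hv → h-fixes-no-arc (arc w v w~v) (hw≡w , sym v≡hv)))

    cubic⇒fixed-point-free : Cubic X → ∀ w → h ⟨$⟩ʳ w ≢ w
    cubic⇒fixed-point-free cubic w hw≡w
      with trans (cong (_% 2) (sym (cubic w))) (fixed-vertex⇒even-degree w hw≡w)
    ... | ()

module _ {N : ℕ} {X : Graph N} {H : Permutation′ N → Set}
         (H≤Aut : IsSubgroupOfAut X H) (H-regular : ArcRegular X H) where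

  private
    H-id : H id
    H-id = proj₁ (proj₂ H≤Aut)

  regular⇒arc-stabiliser-trivial : ∀ {σ} a → H σ → MapsArc X σ a a → ∀ i → σ ⟨$⟩ʳ i ≡ i
  regular⇒arc-stabiliser-trivial a Hσ σ-fixes-a i with H-regular a a
  ... | _ , _ , _ , unique = trans (unique _ Hσ σ-fixes-a i) (sym (unique id H-id (refl , refl) i))

  module _ (a : Arc X) {h : Permutation′ N} (Hh : H h) (h-reverses : MapsArc X h a (reverseArc X a))
    where

    reversal-involutive : Involutive h
    reversal-involutive = regular⇒arc-stabiliser-trivial a (proj₁ (proj₂ (proj₂ H≤Aut)) h h Hh Hh)
      (trans (cong (h ⟨$⟩ʳ_) (proj₁ h-reverses)) (proj₂ h-reverses) ,
       trans (cong (h ⟨$⟩ʳ_) (proj₂ h-reverses)) (proj₁ h-reverses))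

    -- An arc fixed by h would make h the identity, and then a would be a loop.
    reversal-fixes-no-arc : ∀ b → ¬ MapsArc X h b b
    reversal-fixes-no-arc b h-fixes-b
      with trans (sym (loopless X (Arc.a₀ a)))
                 (subst (λ x → Adj X (Arc.a₀ a) x ≡ true) (sym tail≡head) (Arc.adj a))
      where
      tail≡head : Arc.a₀ a ≡ Arc.a₁ a
      tail≡head = trans (sym (regular⇒arc-stabiliser-trivial b Hh h-fixes-b (Arc.a₀ a)))
                        (proj₁ h-reverses)
    ... | ()

proposition4p6 : (n : ℕ) → n % 2 ≡ 1 → (X : Graph (2 * n)) →
    CubicSymmetric X → Type1-2¹ X →
    ∃[ σ ] (IsAut X σ × OddPermutation σ)
proposition4p6 zero () _ _ _
proposition4p6 n@(suc _) n-odd X (_ , cubic , _) (_ , _ , H , H≤Aut , H-regular)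
  with neighbour X cubic zero
... | v , zero~v with H-regular (arc zero v zero~v) (reverseArc X (arc zero v zero~v))
... | h , Hh , h-reverses , _ =
  h , h-aut , FinInvolution.fixed-point-free⇒odd h h-involutive n refl n-odd
                (cubic⇒fixed-point-free X h h-involutive h-aut h-fixes-no-arc cubic)
  where
  h-aut : IsAut X h
  h-aut = proj₁ H≤Aut h Hh
  h-involutive : Involutive h
  h-involutive = reversal-involutive H≤Aut H-regular (arc zero v zero~v) Hh h-reverses
  h-fixes-no-arc : ∀ a → ¬ MapsArc X h a a
  h-fixes-no-arc = reversal-fixes-no-arc H≤Aut H-regular (arc zero v zero~v) Hh h-reverses
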